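{- There are infinitely many pairs $(b,y)$ of integers with $b\ge 2$, $y\ge 1$, for which there exists a word $w$ over $\{0,1,\dots,b-1\}$ with $|w|=2$ such that $(y^4)_b = w\uparrow 2$; equivalently, infinitely many positive integer solutions $(b,y,c)$ of $y^4=c(b^2+1)$ with $b\le c<b^2$.
   Context: $(m)_b$ denotes the canonical base-$b$ representation of the integer $m$ (no leading zeros); $|w|$ is the length of the word $w$ and $w\uparrow n$ is the concatenation of $n$ copies of $w$. -}

module Defs where

open import Data.Nat using (ℕ; zero; suc; _<_; NonZero; _≤_)
open import Data.Nat.DivMod using (_/_; _%_; m%n<n)
open import Data.Fin using (Fin; fromℕ<)
open import Data.List using (List; []; _∷_; _++_; reverse; concat; replicate)

-- little-endian digits of m in base b, using a fuel argument
-- (fuel m suffices since m / b < m for m > 0 and b ≥ 2)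
digitsLE : (fuel b : ℕ) → .{{_ : NonZero b}} → ℕ → List (Fin b)
digitsLE zero    b m       = []
digitsLE (suc f) b zero    = []
digitsLE (suc f) b (suc m) = fromℕ< (m%n<n (suc m) b) ∷ digitsLE f b (suc m / b)

-- (m)_b : canonical base-b representation, most significant digit first,
-- no leading zeros ((0)_b is the empty word).
repr : (b : ℕ) → .{{_ : NonZero b}} → ℕ → List (Fin b)
repr b m = reverse (digitsLE m b m)

_↑_ : ∀ {A : Set} → List A → ℕ → List A
w ↑ n = concat (replicate n w)

≥2⇒NonZero : ∀ {b : ℕ} → 2 ≤ b → NonZero b
≥2⇒NonZero (Data.Nat.s≤s _) = _

-- If x² + 1 = 125 m², put b = x, y = 5m and c = 5m². Then y⁴ = 625 m⁴ = c (b² + 1) = c b² + c,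
-- and b ≤ c < b², so c is a two-digit word in base b and y⁴ is that word written twice.
-- The equation x² − 125 m² = −1 has infinitely many solutions, obtained from (682, 61)
-- by repeated multiplication with a unit of norm 1 in ℤ[√125].
module Submission where

open import Defs
open import Data.Nat
open import Data.Nat.Properties
open import Data.Nat.DivMod
open import Data.Nat.Solver using (module +-*-Solver)
open import Data.Digit using (fromDigits)
open import Data.Fin using (Fin; fromℕ<; toℕ)
open import Data.Fin.Properties using (toℕ-injective; toℕ-fromℕ<; toℕ<n)
open import Data.List using (List; []; _∷_; _∷ʳ_; _++_; length; reverse)
open import Data.Product using (Σ; _×_; _,_; proj₁; proj₂; map₂)
open import Relation.Nullary using (yes; no; contradiction)
open import Relation.Binary.PropositionalEquality
open +-*-Solver

[r+kn]/n≡k : ∀ r k n .{{_ : NonZero n}} → r < n → (r + k * n) / n ≡ k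
[r+kn]/n≡k r k n r<n = begin
  (r + k * n) / n     ≡⟨ +-distrib-/ r (k * n) r%n+kn%n<n ⟩
  r / n + k * n / n   ≡⟨ cong₂ _+_ (m<n⇒m/n≡0 r<n) (m*n/n≡m k n) ⟩
  k                   ∎
  where
  open ≡-Reasoning
  r%n+kn%n<n : r % n + (k * n) % n < n
  r%n+kn%n<n = subst (λ t → r % n + t < n) (sym (m*n%n≡0 k n))
    (subst (_< n) (sym (+-identityʳ (r % n))) (m%n<n r n))

m*m<n*n⇒m<n : ∀ {m n} → m * m < n * n → m < n
m*m<n*n⇒m<n {m} {n} mm<nn with m <? n
... | yes m<n = m<n
... | no  m≮n = contradiction mm<nn (≤⇒≯ (*-mono-≤ (≮⇒≥ m≮n) (≮⇒≥ m≮n)))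

module _ {b : ℕ} .{{_ : NonZero b}} where

  digitsLE-zero : ∀ f → digitsLE f b 0 ≡ []
  digitsLE-zero zero    = refl
  digitsLE-zero (suc f) = refl

  digitsLE-suc : ∀ f m → 0 < m → digitsLE (suc f) b m ≡ fromℕ< (m%n<n m b) ∷ digitsLE f b (m / b)
  digitsLE-suc f (suc m) _ = refl

  digitsLE-fromDigits-∷ : ∀ f (d : Fin b) ds → 0 < fromDigits (d ∷ ds) →
    digitsLE (suc f) b (fromDigits (d ∷ ds)) ≡ d ∷ digitsLE f b (fromDigits ds)
  digitsLE-fromDigits-∷ f d ds pos =
    trans (digitsLE-suc f _ pos) (cong₂ _∷_ lowDigit (cong (digitsLE f b) quotient))
    where
    quotient : fromDigits (d ∷ ds) / b ≡ fromDigits ds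
    quotient = [r+kn]/n≡k (toℕ d) (fromDigits ds) b (toℕ<n d)
    lowDigit : fromℕ< (m%n<n (fromDigits (d ∷ ds)) b) ≡ d
    lowDigit = toℕ-injective (begin
      toℕ (fromℕ< _)                    ≡⟨ toℕ-fromℕ< _ ⟩
      (toℕ d + fromDigits ds * b) % b   ≡⟨ [m+kn]%n≡m%n (toℕ d) (fromDigits ds) b ⟩
      toℕ d % b                         ≡⟨ m<n⇒m%n≡m (toℕ<n d) ⟩
      toℕ d                             ∎)
      where open ≡-Reasoning

  fromDigits-∷ʳ-positive : ∀ (d : Fin b) ds → 0 < toℕ d → 0 < fromDigits (ds ∷ʳ d)
  fromDigits-∷ʳ-positive d []       pos = ≤-trans pos (m≤m+n (toℕ d) _)
  fromDigits-∷ʳ-positive d (e ∷ ds) pos = ≤-trans (fromDigits-∷ʳ-positive d ds pos)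
    (≤-trans (m≤m*n _ b) (m≤n+m _ (toℕ e)))

  -- So the fuel m in repr b m suffices; b ≥ 2 because 0 < toℕ d < b.
  length≤fromDigits : ∀ (d : Fin b) ds → 0 < toℕ d → length (ds ∷ʳ d) ≤ fromDigits (ds ∷ʳ d)
  length≤fromDigits d []       pos = ≤-trans pos (m≤m+n (toℕ d) _)
  length≤fromDigits d (e ∷ ds) pos = begin
    suc (length (ds ∷ʳ d))  ≤⟨ s≤s (length≤fromDigits d ds pos) ⟩
    suc v                   ≡⟨ +-comm 1 v ⟩
    v + 1                   ≤⟨ +-monoʳ-≤ v (fromDigits-∷ʳ-positive d ds pos) ⟩
    v + v                   ≡⟨ cong (v +_) (sym (+-identityʳ v)) ⟩
    2 * v                   ≤⟨ *-monoˡ-≤ v (≤-trans (s≤s pos) (toℕ<n d)) ⟩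
    b * v                   ≡⟨ *-comm b v ⟩
    v * b                   ≤⟨ m≤n+m (v * b) (toℕ e) ⟩
    toℕ e + v * b           ∎
    where
    open ≤-Reasoning
    v = fromDigits (ds ∷ʳ d)

  digitsLE-fromDigits : ∀ f (d : Fin b) ds → 0 < toℕ d → length (ds ∷ʳ d) ≤ f →
    digitsLE f b (fromDigits (ds ∷ʳ d)) ≡ ds ∷ʳ d
  digitsLE-fromDigits (suc f) d [] pos _ = begin
    digitsLE (suc f) b (fromDigits (d ∷ []))  ≡⟨ digitsLE-fromDigits-∷ f d [] (fromDigits-∷ʳ-positive d [] pos) ⟩
    d ∷ digitsLE f b 0                        ≡⟨ cong (d ∷_) (digitsLE-zero f) ⟩
    d ∷ []                                    ∎
    where open ≡-Reasoning
  digitsLE-fromDigits (suc f) d (e ∷ ds) pos (s≤s len≤f) = begin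
    digitsLE (suc f) b (fromDigits (e ∷ ds ∷ʳ d))  ≡⟨ digitsLE-fromDigits-∷ f e (ds ∷ʳ d) (fromDigits-∷ʳ-positive d (e ∷ ds) pos) ⟩
    e ∷ digitsLE f b (fromDigits (ds ∷ʳ d))        ≡⟨ cong (e ∷_) (digitsLE-fromDigits f d ds pos len≤f) ⟩
    e ∷ ds ∷ʳ d                                    ∎
    where open ≡-Reasoning

  repr-fromDigits : ∀ (d : Fin b) ds → 0 < toℕ d → repr b (fromDigits (ds ∷ʳ d)) ≡ reverse (ds ∷ʳ d)
  repr-fromDigits d ds pos = cong reverse (digitsLE-fromDigits _ d ds pos (length≤fromDigits d ds pos))

  fromDigits-++ : ∀ (ds es : List (Fin b)) → fromDigits (ds ++ es) ≡ fromDigits ds + fromDigits es * b ^ length ds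
  fromDigits-++ []       es = solve 1 (λ v → v := con 0 :+ v :* con 1) refl (fromDigits es)
  fromDigits-++ (d ∷ ds) es = begin
    toℕ d + fromDigits (ds ++ es) * b                          ≡⟨ cong (λ v → toℕ d + v * b) (fromDigits-++ ds es) ⟩
    toℕ d + (fromDigits ds + fromDigits es * b ^ length ds) * b
      ≡⟨ solve 5 (λ t u v b p → t :+ (u :+ v :* p) :* b := (t :+ u :* b) :+ v :* (b :* p))
               refl (toℕ d) (fromDigits ds) (fromDigits es) b (b ^ length ds) ⟩
    (toℕ d + fromDigits ds * b) + fromDigits es * (b * b ^ length ds) ∎
    where open ≡-Reasoning

  -- b ≤ c < b² makes c / b a nonzero digit.
  repr-repeat₂ : ∀ c → b ≤ c → c < b * b →
    Σ (List (Fin b)) λ w → length w ≡ 2 × repr b (c * (b * b + 1)) ≡ w ↑ 2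
  repr-repeat₂ c b≤c c<bb = q ∷ r ∷ [] , refl ,
    (begin
      repr b (c * (b * b + 1))               ≡⟨ cong (repr b) (sym value) ⟩
      repr b (fromDigits (u ++ u))           ≡⟨ repr-fromDigits q (r ∷ q ∷ r ∷ []) q-positive ⟩
      reverse (u ++ u)                       ∎)
    where
    open ≡-Reasoning
    q : Fin b
    q = fromℕ< (m<n*o⇒m/o<n c<bb)
    r : Fin b
    r = fromℕ< (m%n<n c b)
    u : List (Fin b)
    u = r ∷ q ∷ []
    q-positive : 0 < toℕ q
    q-positive = subst (0 <_) (sym (toℕ-fromℕ< _)) (m≥n⇒m/n>0 b≤c)
    value-u : fromDigits u ≡ c
    value-u = begin
      toℕ r + (toℕ q + 0) * b  ≡⟨ cong₂ (λ s t → s + (t + 0) * b) (toℕ-fromℕ< (m%n<n c b)) (toℕ-fromℕ< (m<n*o⇒m/o<n c<bb)) ⟩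
      c % b + (c / b + 0) * b  ≡⟨ cong (λ t → c % b + t * b) (+-identityʳ (c / b)) ⟩
      c % b + c / b * b        ≡⟨ sym (m≡m%n+[m/n]*n c b) ⟩
      c                        ∎
    value : fromDigits (u ++ u) ≡ c * (b * b + 1)
    value = begin
      fromDigits (u ++ u)                  ≡⟨ fromDigits-++ u u ⟩
      fromDigits u + fromDigits u * b ^ 2  ≡⟨ cong (λ v → v + v * b ^ 2) value-u ⟩
      c + c * b ^ 2                        ≡⟨ solve 2 (λ c b → c :+ c :* (b :^ 2) := c :* (b :* b :+ con 1)) refl c b ⟩
      c * (b * b + 1)                      ∎

record NegativePellSolution (D : ℕ) : Set where
  field
    x m      : ℕ
    equation : x * x + 1 ≡ D * (m * m)

-- Multiplying x + m√D by a unit X + Y√D of norm 1 preserves the norm -1.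
composeWithUnit : ∀ {D} X Y → X * X ≡ 1 + D * (Y * Y) → NegativePellSolution D → NegativePellSolution D
composeWithUnit {D} X Y unit s = record
  { x = X * x + D * Y * m ; m = Y * x + X * m ; equation = equation′ }
  where
  open NegativePellSolution s
  open ≡-Reasoning
  cross : ℕ
  cross = 2 * D * (X * Y * x * m) + D * D * (Y * Y) * (m * m)
  equation′ : (X * x + D * Y * m) * (X * x + D * Y * m) + 1 ≡ D * ((Y * x + X * m) * (Y * x + X * m))
  equation′ = begin
    (X * x + D * Y * m) * (X * x + D * Y * m) + 1
      ≡⟨ solve 5 (λ D X Y x m → (X :* x :+ D :* Y :* m) :* (X :* x :+ D :* Y :* m) :+ con 1
                  := X :* X :* (x :* x) :+ (con 2 :* D :* (X :* Y :* x :* m) :+ D :* D :* (Y :* Y) :* (m :* m)) :+ con 1)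
               refl D X Y x m ⟩
    X * X * (x * x) + cross + 1
      ≡⟨ cong (λ v → v * (x * x) + cross + 1) unit ⟩
    (1 + D * (Y * Y)) * (x * x) + cross + 1
      ≡⟨ solve 4 (λ D Y x w → (con 1 :+ D :* (Y :* Y)) :* (x :* x) :+ w :+ con 1 := (x :* x :+ con 1) :+ (D :* (Y :* Y) :* (x :* x) :+ w))
               refl D Y x cross ⟩
    (x * x + 1) + (D * (Y * Y) * (x * x) + cross)
      ≡⟨ cong (_+ (D * (Y * Y) * (x * x) + cross)) equation ⟩
    D * (m * m) + (D * (Y * Y) * (x * x) + cross)
      ≡⟨ solve 5 (λ D X Y x m → D :* (m :* m) :+ (D :* (Y :* Y) :* (x :* x) :+ (con 2 :* D :* (X :* Y :* x :* m) :+ D :* D :* (Y :* Y) :* (m :* m)))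
                  := D :* (Y :* Y :* (x :* x) :+ con 2 :* (X :* Y :* x :* m) :+ (con 1 :+ D :* (Y :* Y)) :* (m :* m)))
               refl D X Y x m ⟩
    D * (Y * Y * (x * x) + 2 * (X * Y * x * m) + (1 + D * (Y * Y)) * (m * m))
      ≡⟨ cong (λ v → D * (Y * Y * (x * x) + 2 * (X * Y * x * m) + v * (m * m))) (sym unit) ⟩
    D * (Y * Y * (x * x) + 2 * (X * Y * x * m) + X * X * (m * m))
      ≡⟨ solve 5 (λ D X Y x m → D :* (Y :* Y :* (x :* x) :+ con 2 :* (X :* Y :* x :* m) :+ X :* X :* (m :* m))
                  := D :* ((Y :* x :+ X :* m) :* (Y :* x :+ X :* m)))
               refl D X Y x m ⟩
    D * ((Y * x + X * m) * (Y * x + X * m)) ∎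

-- 682² + 1 = 125 · 61², and 930249 + 83204√125 = (682 + 61√125)².
negPell125 : ℕ → NegativePellSolution 125
negPell125 zero    = record { x = 682 ; m = 61 ; equation = refl }
negPell125 (suc n) = composeWithUnit 930249 83204 refl (negPell125 n)

negPell125-bounds : ∀ n → let open NegativePellSolution (negPell125 n) in 2 ≤ x × 3 + n ≤ m
negPell125-bounds zero    = s≤s (s≤s z≤n) , s≤s (s≤s (s≤s z≤n))
negPell125-bounds (suc n) =
  ≤-trans 2≤x (≤-trans (m≤n*m x 930249) (m≤m+n _ _)) ,
  ≤-trans (s≤s 3+n≤m) (+-mono-≤ (≤-trans (s≤s z≤n) (≤-trans 2≤x (m≤n*m x 83204))) (m≤n*m m 930249))
  where
  open NegativePellSolution (negPell125 n)
  2≤x : 2 ≤ x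
  2≤x = proj₁ (negPell125-bounds n)
  3+n≤m : 3 + n ≤ m
  3+n≤m = proj₂ (negPell125-bounds n)

module _ (s : NegativePellSolution 125) where
  open NegativePellSolution s

  [5m]⁴≡5m²[x²+1] : (5 * m) ^ 4 ≡ 5 * (m * m) * (x * x + 1)
  [5m]⁴≡5m²[x²+1] = begin
    (5 * m) ^ 4                      ≡⟨ solve 1 (λ m → (con 5 :* m) :^ 4 := con 5 :* (m :* m) :* (con 125 :* (m :* m))) refl m ⟩
    5 * (m * m) * (125 * (m * m))    ≡⟨ cong (5 * (m * m) *_) (sym equation) ⟩
    5 * (m * m) * (x * x + 1)        ∎
    where open ≡-Reasoning

  x≤5m² : 3 ≤ m → x ≤ 5 * (m * m)
  x≤5m² 3≤m = <⇒≤ (m*m<n*n⇒m<n (begin-strict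
    x * x                       <⟨ m<m+n (x * x) z<s ⟩
    x * x + 1                   ≡⟨ equation ⟩
    125 * (m * m)               ≡⟨ solve 1 (λ m → con 125 :* (m :* m) := con 25 :* (m :* m) :* con 5) refl m ⟩
    25 * (m * m) * 5            ≤⟨ *-monoʳ-≤ (25 * (m * m)) (≤-trans (s≤s (s≤s (s≤s (s≤s (s≤s z≤n))))) (*-mono-≤ 3≤m 3≤m)) ⟩
    25 * (m * m) * (m * m)      ≡⟨ solve 1 (λ m → con 25 :* (m :* m) :* (m :* m) := con 5 :* (m :* m) :* (con 5 :* (m :* m))) refl m ⟩
    5 * (m * m) * (5 * (m * m)) ∎))
    where open ≤-Reasoning

  5m²<x² : 1 ≤ m → 5 * (m * m) < x * x
  5m²<x² 1≤m = +-cancelʳ-≤ 1 (suc (5 * (m * m))) (x * x) (begin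
    suc (5 * (m * m)) + 1           ≡⟨ +-comm (suc (5 * (m * m))) 1 ⟩
    2 + 5 * (m * m)                 ≤⟨ +-monoˡ-≤ (5 * (m * m)) (≤-trans (s≤s (s≤s z≤n)) (*-monoʳ-≤ 120 (*-mono-≤ 1≤m 1≤m))) ⟩
    120 * (m * m) + 5 * (m * m)     ≡⟨ solve 1 (λ m → con 120 :* (m :* m) :+ con 5 :* (m :* m) := con 125 :* (m :* m)) refl m ⟩
    125 * (m * m)                   ≡⟨ sym equation ⟩
    x * x + 1                       ∎)
    where open ≤-Reasoning

mainTheorem14 : (N : ℕ) → Σ ℕ λ b → Σ ℕ λ y → Σ (2 ≤ b) λ hb →
    1 ≤ y × N < b + y ×
    Σ (List (Fin b)) (λ w → length w ≡ 2 ×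
    repr b {{≥2⇒NonZero hb}} (y ^ 4) ≡ w ↑ 2)
mainTheorem14 N = x , 5 * m , 2≤x , 1≤5m , N<x+5m ,
  map₂ (map₂ (trans (cong (repr x) ([5m]⁴≡5m²[x²+1] s))))
    (repr-repeat₂ (5 * (m * m)) (x≤5m² s 3≤m) (5m²<x² s 1≤m))
  where
  s : NegativePellSolution 125
  s = negPell125 N
  open NegativePellSolution s
  2≤x : 2 ≤ x
  2≤x = proj₁ (negPell125-bounds N)
  3+N≤m : 3 + N ≤ m
  3+N≤m = proj₂ (negPell125-bounds N)
  instance
    x≢0 : NonZero x
    x≢0 = ≥2⇒NonZero 2≤x
  3≤m : 3 ≤ m
  3≤m = ≤-trans (m≤m+n 3 N) 3+N≤m
  1≤m : 1 ≤ m
  1≤m = ≤-trans (s≤s z≤n) 3≤m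
  1≤5m : 1 ≤ 5 * m
  1≤5m = ≤-trans 1≤m (m≤n*m m 5)
  N<x+5m : N < x + 5 * m
  N<x+5m = ≤-trans (s≤s (≤-trans (m≤n+m N 3) 3+N≤m)) (+-mono-≤ (≤-trans (s≤s z≤n) 2≤x) (m≤n*m m 5))
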